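{- Let $g(n)$ be the label of the parent of the vertex labelled $n+1$ in the labelled infinite tree $\mathcal G$ defined below, and let $F_n$ be the Fibonacci numbers ($F_1=F_2=1$, $F_n=F_{n-1}+F_{n-2}$). Then $g(F_n)=F_{n-1}$ for all $n\ge 2$.
   Context: The tree $\mathcal G$ is the infinite rooted plane tree (children of each vertex are ordered from left to right) defined recursively as follows: the root has a left child and a right child; the subtree rooted at the left child is a copy of $\mathcal G$; the right child has exactly one child, and the subtree rooted at that child is a copy of $\mathcal G$. Equivalently, vertices are of two types: a vertex of type A has exactly two children, the left of type A and the right of type B; a vertex of type B has exactly one child, of type A; the root is of type A. The vertices are labelled by the positive integers: the root gets label $1$, and then vertices are labelled consecutively in increasing order of height, and, within a fixed height, in increasing order from right to left. -}

module Defs where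

open import Data.Nat using (ℕ; zero; suc; _+_)
open import Data.List using (List; []; _∷_; concatMap; reverse; length; lookup)
open import Data.Fin using (Fin; toℕ)
open import Data.Product using (Σ; _×_)
open import Relation.Binary.PropositionalEquality using (_≡_)

fib : ℕ → ℕ
fib 0 = 0
fib 1 = 1
fib (suc (suc n)) = fib (suc n) + fib n

data VType : Set where
  A B : VType

-- A vertex is the path from the root, stored in REVERSE order
-- (most recent step first).  A step is the index of the child taken,
-- 0 = leftmost child.  Thus the parent of (c ∷ p) is p.
Vertex : Set
Vertex = List ℕ

-- Type of a vertex: the root is of type A; the left child (index 0) of any
-- vertex is of type A (the only child of a B vertex is A, the left child of an
-- A vertex is A); the right child (index 1) of an A vertex is of type B.
typeOf : Vertex → VType
typeOf [] = A
typeOf (zero ∷ _) = A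
typeOf (suc _ ∷ _) = B

children : Vertex → List Vertex
children v with typeOf v
... | A = (0 ∷ v) ∷ (1 ∷ v) ∷ []
... | B = (0 ∷ v) ∷ []

level : ℕ → List Vertex
level zero = [] ∷ []
level (suc h) = concatMap children (level h)

below : ℕ → ℕ
below zero = 0
below (suc h) = below h + length (level h)

-- Labels are assigned
-- consecutively starting from 1, by increasing height, and within a height
-- from right to left: the i-th vertex (0-based) of height h counted from the
-- right gets label below h + i + 1.
HasLabel : ℕ → Vertex → Set
HasLabel k v =
  Σ ℕ λ h → Σ (Fin (length (reverse (level h)))) λ i →
    (lookup (reverse (level h)) i ≡ v) × (k ≡ suc (below h + toℕ i))

-- Parent of a vertex (the root is sent to itself; never used for the root).
parent : Vertex → Vertex
parent [] = []
parent (_ ∷ p) = p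

module Submission where

-- Since the
-- levels occupy consecutive blocks of labels, the pair (h , j), and hence the
-- vertex, is determined by its label: labels are unique.  It therefore
-- suffices to exhibit, for each n ≥ 2, ONE vertex labelled F n + 1 whose
-- parent is labelled F (n - 1).
--
-- Counting: an A vertex has 2 children and 3 grandchildren, a B vertex 1 and
-- 2; so |level (h + 2)| = |level (h + 1)| + |level h| and |level h| = F (h + 2),
-- giving below h + 2 = F (h + 3).  Hence label F (h + 5) + 1 is the third
-- vertex from the right at height h + 2, and label F (h + 4) is the second
-- vertex from the right at height h + 1.  Reading levels right to left, the
-- two rightmost vertices x , y of a level satisfy "x of type B ⇒ y of type A";
-- this invariant propagates and forces the third vertex of the next level to
-- be a child of y.  The cases n = 2, 3, 4 are checked by computation.

open import Defs
open import Data.Nat using (ℕ; zero; suc; _+_; _∸_; _≤_; _<_; _≤′_; ≤′-refl; ≤′-step; s≤s)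
open import Data.Nat.Properties
  using (+-assoc; +-comm; +-suc; m≤m+n; ≤-refl; ≤-trans; <-≤-trans; +-monoʳ-<;
         +-cancelˡ-≡; <-cmp; <-irrefl; ≤⇒≤′; suc-injective)
open import Data.List using (List; []; _∷_; _++_; [_]; concatMap; reverse; length; lookup)
open import Data.List.Properties
  using (reverse-++; concatMap-++; length-++; length-reverse; unfold-reverse; ++-identityʳ)
open import Data.Empty using (⊥-elim)
open import Data.Fin using (Fin; toℕ)
import Data.Fin as Fin
open import Data.Fin.Properties using (toℕ-injective; toℕ<n)
open import Data.Product using (Σ; _×_; _,_)
open import Function using (_∘_)
open import Relation.Binary.PropositionalEquality
  using (_≡_; refl; sym; trans; cong; cong₂; subst; subst₂; module ≡-Reasoning)
open import Relation.Binary.Definitions using (tri<; tri≈; tri>)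

reverse-concatMap : ∀ {X Y : Set} (f : X → List Y) (xs : List X) →
  reverse (concatMap f xs) ≡ concatMap (reverse ∘ f) (reverse xs)
reverse-concatMap f [] = refl
reverse-concatMap f (x ∷ xs) = begin
    reverse (f x ++ concatMap f xs)
  ≡⟨ reverse-++ (f x) (concatMap f xs) ⟩
    reverse (concatMap f xs) ++ reverse (f x)
  ≡⟨ cong₂ _++_ (reverse-concatMap f xs) (sym (++-identityʳ (reverse (f x)))) ⟩
    concatMap (reverse ∘ f) (reverse xs) ++ concatMap (reverse ∘ f) [ x ]
  ≡⟨ sym (concatMap-++ (reverse ∘ f) (reverse xs) [ x ]) ⟩
    concatMap (reverse ∘ f) (reverse xs ++ [ x ])
  ≡⟨ cong (concatMap (reverse ∘ f)) (sym (unfold-reverse x xs)) ⟩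
    concatMap (reverse ∘ f) (reverse (x ∷ xs)) ∎
  where open ≡-Reasoning

length-concatMap² : ∀ {X : Set} (f : X → List X) →
  (∀ x → length (concatMap f (f x)) ≡ length (f x) + 1) →
  ∀ xs → length (concatMap f (concatMap f xs)) ≡ length (concatMap f xs) + length xs
length-concatMap² f grand [] = refl
length-concatMap² f grand (x ∷ xs) = begin
    length (concatMap f (f x ++ concatMap f xs))
  ≡⟨ cong length (concatMap-++ f (f x) (concatMap f xs)) ⟩
    length (concatMap f (f x) ++ concatMap f (concatMap f xs))
  ≡⟨ length-++ (concatMap f (f x)) ⟩
    length (concatMap f (f x)) + length (concatMap f (concatMap f xs))
  ≡⟨ cong₂ _+_ (grand x) (length-concatMap² f grand xs) ⟩
    (length (f x) + 1) + (length (concatMap f xs) + length xs)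
  ≡⟨ regroup (length (f x)) (length (concatMap f xs)) (length xs) ⟩
    (length (f x) + length (concatMap f xs)) + suc (length xs)
  ≡⟨ cong (_+ suc (length xs)) (sym (length-++ (f x))) ⟩
    length (f x ++ concatMap f xs) + suc (length xs) ∎
  where
  open ≡-Reasoning
  regroup : ∀ a b c → (a + 1) + (b + c) ≡ (a + b) + suc c
  regroup a b c = begin
      (a + 1) + (b + c) ≡⟨ +-assoc a 1 (b + c) ⟩
      a + suc (b + c)   ≡⟨ cong (a +_) (sym (+-suc b c)) ⟩
      a + (b + suc c)   ≡⟨ sym (+-assoc a b (suc c)) ⟩
      (a + b) + suc c   ∎

position : ∀ {X : Set} {L : List X} (pre : List X) (v : X) (post : List X) →
  L ≡ pre ++ v ∷ post →
  Σ (Fin (length L)) λ i → (lookup L i ≡ v) × (toℕ i ≡ length pre)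
position [] v post refl = Fin.zero , refl , refl
position (x ∷ pre) v post refl with position pre v post refl
... | i , at , index = Fin.suc i , at , cong suc index

grandchildren : ∀ v → length (concatMap children (children v)) ≡ length (children v) + 1
grandchildren v with typeOf v
... | A = refl
... | B = refl

level-length : ∀ h → length (level h) ≡ fib (2 + h)
level-length zero = refl
level-length (suc zero) = refl
level-length (suc (suc h)) =
  trans (length-concatMap² children grandchildren (level h))
        (cong₂ _+_ (level-length (suc h)) (level-length h))

below-fib : ∀ h → below h + 2 ≡ fib (3 + h)
below-fib zero = refl
below-fib (suc h) = begin
    (below h + length (level h)) + 2 ≡⟨ +-assoc (below h) (length (level h)) 2 ⟩
    below h + (length (level h) + 2) ≡⟨ cong (below h +_) (+-comm (length (level h)) 2) ⟩
    below h + (2 + length (level h)) ≡⟨ sym (+-assoc (below h) 2 (length (level h))) ⟩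
    (below h + 2) + length (level h) ≡⟨ cong₂ _+_ (below-fib h) (level-length h) ⟩
    fib (3 + h) + fib (2 + h)        ∎
  where open ≡-Reasoning

below-mono : ∀ {h h'} → h ≤′ h' → below h ≤ below h'
below-mono ≤′-refl = ≤-refl
below-mono (≤′-step h≤h') = ≤-trans (below-mono h≤h') (m≤m+n _ _)

slot-before : ∀ {h h' j j'} → h < h' → j < length (level h) → below h + j < below h' + j'
slot-before {h} {h'} {j} {j'} h<h' j<len = <-≤-trans
  (+-monoʳ-< (below h) j<len)
  (≤-trans (below-mono (≤⇒≤′ h<h')) (m≤m+n (below h') j'))

slot-height : ∀ {h h' j j'} → j < length (level h) → j' < length (level h') →
  below h + j ≡ below h' + j' → h ≡ h'
slot-height {h} {h'} j<len j'<len same with <-cmp h h'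
... | tri< h<h' _ _ = ⊥-elim (<-irrefl same (slot-before h<h' j<len))
... | tri≈ _ h≡h' _ = h≡h'
... | tri> _ _ h>h' = ⊥-elim (<-irrefl (sym same) (slot-before h>h' j'<len))

index-bound : ∀ h (i : Fin (length (reverse (level h)))) → toℕ i < length (level h)
index-bound h i = subst (toℕ i <_) (length-reverse (level h)) (toℕ<n i)

label-unique : ∀ {k v w} → HasLabel k v → HasLabel k w → v ≡ w
label-unique {k} {v} {w} (h , i , at-i , k≡) (h' , i' , at-i' , k≡')
  with slot-height {h} {h'} (index-bound h i) (index-bound h' i') (suc-injective (trans (sym k≡) k≡'))
... | refl = begin
    v                                ≡⟨ sym at-i ⟩
    lookup (reverse (level h)) i     ≡⟨ cong (lookup (reverse (level h))) i≡i' ⟩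
    lookup (reverse (level h)) i'    ≡⟨ at-i' ⟩
    w                                ∎
  where
  open ≡-Reasoning
  i≡i' : i ≡ i'
  i≡i' = toℕ-injective (+-cancelˡ-≡ (below h) _ _ (suc-injective (trans (sym k≡) k≡')))

labelled : ∀ h pre v post → reverse (level h) ≡ pre ++ v ∷ post →
  HasLabel (suc (below h + length pre)) v
labelled h pre v post split with position pre v post split
... | i , at , index = h , i , at , cong (λ j → suc (below h + j)) (sym index)

rch : Vertex → List Vertex
rch = reverse ∘ children

rightToLeft-suc : ∀ h → reverse (level (suc h)) ≡ concatMap rch (reverse (level h))
rightToLeft-suc h = reverse-concatMap children (level h)

expand : ∀ x y rest → (typeOf x ≡ B → typeOf y ≡ A) →
  Σ Vertex λ x' → Σ Vertex λ y' → Σ Vertex λ v → Σ (List Vertex) λ rest' →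
    (concatMap rch (x ∷ y ∷ rest) ≡ x' ∷ y' ∷ v ∷ rest')
    × (typeOf x' ≡ B → typeOf y' ≡ A) × (parent v ≡ y)
expand x y rest invariant with typeOf x | typeOf y
... | A | A = _ , _ , _ , _ , refl , (λ _ → refl) , refl
... | A | B = _ , _ , _ , _ , refl , (λ _ → refl) , refl
... | B | A = _ , _ , _ , _ , refl , (λ ()) , refl
... | B | B with invariant refl
...   | ()

rightmost-pair : ∀ h → Σ Vertex λ x → Σ Vertex λ y → Σ (List Vertex) λ rest →
  (reverse (level (suc h)) ≡ x ∷ y ∷ rest) × (typeOf x ≡ B → typeOf y ≡ A)
rightmost-pair zero = _ , _ , _ , refl , (λ _ → refl)
rightmost-pair (suc h) with rightmost-pair h
... | x , y , rest , split , invariant with expand x y rest invariant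
...   | x' , y' , v , rest' , split' , invariant' , _ =
  x' , y' , v ∷ rest' ,
  trans (rightToLeft-suc (suc h)) (trans (cong (concatMap rch) split) split') ,
  invariant'

third-vertex : ∀ h → Σ Vertex λ v → HasLabel (fib (5 + h) + 1) v × HasLabel (fib (4 + h)) (parent v)
third-vertex h with rightmost-pair h
... | x , y , rest , split , invariant with expand x y rest invariant
...   | x' , y' , v , rest' , split' , _ , parent≡y =
  v ,
  subst (λ k → HasLabel k v) label-v
    (labelled (2 + h) (x' ∷ y' ∷ []) v rest'
      (trans (rightToLeft-suc (suc h)) (trans (cong (concatMap rch) split) split'))) ,
  subst₂ HasLabel label-y (sym parent≡y) (labelled (1 + h) (x ∷ []) y rest split)
  where
  label-v : suc (below (2 + h) + 2) ≡ fib (5 + h) + 1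
  label-v = trans (cong suc (below-fib (2 + h))) (+-comm 1 (fib (5 + h)))
  label-y : suc (below (1 + h) + 1) ≡ fib (4 + h)
  label-y = trans (sym (+-suc (below (1 + h)) 1)) (below-fib (1 + h))

witness : ∀ n → 2 ≤ n → Σ Vertex λ v → HasLabel (fib n + 1) v × HasLabel (fib (n ∸ 1)) (parent v)
witness 0 ()
witness 1 (s≤s ())
witness 2 _ = (1 ∷ []) , (1 , Fin.zero , refl , refl) , (0 , Fin.zero , refl , refl)
witness 3 _ = (0 ∷ []) , (1 , Fin.suc Fin.zero , refl , refl) , (0 , Fin.zero , refl , refl)
witness 4 _ = (0 ∷ 1 ∷ []) , (2 , Fin.zero , refl , refl) , (1 , Fin.zero , refl , refl)
witness (suc (suc (suc (suc (suc h))))) _ = third-vertex h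

corollary2p3 : (n : ℕ) → 2 ≤ n →
    Σ Vertex (λ v → HasLabel (fib n + 1) v)
      × ((v : Vertex) → HasLabel (fib n + 1) v → HasLabel (fib (n ∸ 1)) (parent v))
corollary2p3 n 2≤n with witness n 2≤n
... | v , v-label , parent-label =
  (v , v-label) ,
  λ w w-label → subst (HasLabel (fib (n ∸ 1)) ∘ parent) (label-unique v-label w-label) parent-label
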